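{- For any integers $n$ and $k$ with $8\leq k\leq \frac{2n}{3}-1$, there exists a graph $G$ of order $n$ with minimum degree $\delta(G)\geq 2$ and $\gamma_{t[1,2]}(G)=k$.
   Context: All graphs are finite, simple and undirected; $N(v)$ denotes the neighborhood of $v$. A set $S\subseteq V(G)$ is a total $[1,2]$-set of $G$ if $1\leq |N(v)\cap S|\leq 2$ for every vertex $v\in V(G)$. $\gamma_{t[1,2]}(G)$ is the minimum cardinality of a total $[1,2]$-set of $G$, with $\gamma_{t[1,2]}(G)=+\infty$ if no such set exists. -}

module Defs where

open import Data.Nat using (ℕ; _≤_)
open import Data.Bool using (Bool; true; false; if_then_else_)
open import Data.Fin using (Fin)
open import Data.Fin.Subset using (Subset; inside; outside; _∩_; ∣_∣)
open import Data.Vec using (tabulate)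
open import Data.Product using (_×_; Σ-syntax)
open import Relation.Binary.PropositionalEquality using (_≡_)

record Graph (n : ℕ) : Set where
  field
    adj     : Fin n → Fin n → Bool
    sym     : ∀ u v → adj u v ≡ adj v u
    irrefl  : ∀ v → adj v v ≡ false

open Graph public

N : ∀ {n} → Graph n → Fin n → Subset n
N G v = tabulate (λ u → if adj G v u then inside else outside)

deg : ∀ {n} → Graph n → Fin n → ℕ
deg G v = ∣ N G v ∣

MinDegAtLeast : ∀ {n} → Graph n → ℕ → Set
MinDegAtLeast G d = ∀ v → d ≤ deg G v

IsTotal12Set : ∀ {n} → Graph n → Subset n → Set
IsTotal12Set G S = ∀ v → 1 ≤ ∣ N G v ∩ S ∣ × ∣ N G v ∩ S ∣ ≤ 2

GammaT12Is : ∀ {n} → Graph n → ℕ → Set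
GammaT12Is {n} G k =
  (Σ[ S ∈ Subset n ] (IsTotal12Set G S × ∣ S ∣ ≡ k))
  × (∀ (S : Subset n) → IsTotal12Set G S → k ≤ ∣ S ∣)

-- Both δ(G) ≥ 2 and γ_{t[1,2]} behave well under disjoint union: a set is a
-- total [1,2]-set of G ⊕ H exactly when its two halves are total [1,2]-sets of
-- G and H, so γ_{t[1,2]}(G ⊕ H) = γ_{t[1,2]}(G) + γ_{t[1,2]}(H).  Every
-- complete graph K_{3+m} has γ_{t[1,2]} = 2 (two vertices serve everybody, and
-- one cannot serve itself), and the 5-cycle has γ_{t[1,2]} = 3.  Hence for
-- k = 2j + 2 take j triangles next to K_{n-3j}, and for k = 2j + 5 add a
-- 5-cycle to j triangles and K_{n-3j-5}; the bound 3(k+1) ≤ 2n leaves at least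
-- three vertices for the complete graph.
module Submission where

open import Defs hiding (sym)
open import Data.Nat using (ℕ; zero; suc; _≤_; _*_; _+_; _∸_; z≤n; s≤s)
import Data.Nat.Properties as ℕ
open import Data.Nat.DivMod using (_mod_)
open import Data.Nat.Tactic.RingSolver using (solve-∀)
open import Data.Bool using (Bool; false; not; _∨_; if_then_else_)
open import Data.Bool.Properties using (∨-comm) renaming (_≟_ to _≟ᴮ_)
open import Data.Fin using (Fin; zero; suc; toℕ; _↑ˡ_; _↑ʳ_; splitAt)
open import Data.Fin.Properties using (_≟_; all?; splitAt-↑ˡ; splitAt-↑ʳ)
open import Data.Fin.Subset
  using (Subset; inside; outside; _∩_; ∣_∣; _∈_; _∉_; ⊥; ∁; ⁅_⁆; Nonempty)
open import Data.Fin.Subset.Properties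
  using (∣⊥∣≡0; ∩-zeroˡ; ∩-zeroʳ; ∣∁p∣≡n∸∣p∣; ∣⁅x⁆∣≡1; x∈⁅y⁆⇒x≡y; x≢y⇒x∉⁅y⁆;
         p⊆q⇒∣p∣≤∣q∣; x∈p∧x∉q⇒x∈p─q; x∈p⇒∣p-x∣<∣p∣; x∈p∩q⁻; anySubset?)
open import Data.Vec using ([]; _∷_; _++_; tabulate; here; there)
import Data.Vec as Vec
open import Data.Vec.Properties using (zipWith-++; tabulate-cong; lookup∘tabulate; []=⇒lookup)
open import Data.Product using (Σ-syntax; _×_; _,_; proj₁)
import Data.Product as Product
open import Data.Sum using (_⊎_; inj₁; inj₂; [_,_]; [_,_]′)
open import Function using (_∘_)
open import Function.Bundles using (mk⇔)
open import Relation.Unary using (Decidable)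
open import Relation.Nullary using (Dec; does)
open import Relation.Nullary.Decidable using (does-⇔; dec-true; toWitness; map′; _×-dec_; ¬?)
open import Relation.Binary.PropositionalEquality
open ≡-Reasoning

∣p++q∣≡∣p∣+∣q∣ : ∀ {m n} (p : Subset m) (q : Subset n) → ∣ p ++ q ∣ ≡ ∣ p ∣ + ∣ q ∣
∣p++q∣≡∣p∣+∣q∣ []            q = refl
∣p++q∣≡∣p∣+∣q∣ (inside  ∷ p) q = cong suc (∣p++q∣≡∣p∣+∣q∣ p q)
∣p++q∣≡∣p∣+∣q∣ (outside ∷ p) q = ∣p++q∣≡∣p∣+∣q∣ p q

∣p++q∩r++s∣≡∣p∩r∣+∣q∩s∣ : ∀ {m n} (p r : Subset m) (q s : Subset n) →
              ∣ (p ++ q) ∩ (r ++ s) ∣ ≡ ∣ p ∩ r ∣ + ∣ q ∩ s ∣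
∣p++q∩r++s∣≡∣p∩r∣+∣q∩s∣ p r q s = begin
  ∣ (p ++ q) ∩ (r ++ s) ∣      ≡⟨ cong ∣_∣ (zipWith-++ _ p q r s) ⟩
  ∣ (p ∩ r) ++ (q ∩ s) ∣       ≡⟨ ∣p++q∣≡∣p∣+∣q∣ (p ∩ r) (q ∩ s) ⟩
  ∣ p ∩ r ∣ + ∣ q ∩ s ∣        ∎

∣p∩⊥∣≡0 : ∀ {n} (p : Subset n) → ∣ p ∩ ⊥ ∣ ≡ 0
∣p∩⊥∣≡0 {n} p = trans (cong ∣_∣ (∩-zeroʳ p)) (∣⊥∣≡0 n)

∣⊥∩p∣≡0 : ∀ {n} (p : Subset n) → ∣ ⊥ ∩ p ∣ ≡ 0
∣⊥∩p∣≡0 {n} p = trans (cong ∣_∣ (∩-zeroˡ p)) (∣⊥∣≡0 n)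

1≤∣p∣⇒Nonempty : ∀ {n} (p : Subset n) → 1 ≤ ∣ p ∣ → Nonempty p
1≤∣p∣⇒Nonempty (inside  ∷ p) _      = zero , here
1≤∣p∣⇒Nonempty (outside ∷ p) 1≤∣p∣ = Product.map suc there (1≤∣p∣⇒Nonempty p 1≤∣p∣)

x∈p⇒1≤∣p∣ : ∀ {n} {x : Fin n} {p : Subset n} → x ∈ p → 1 ≤ ∣ p ∣
x∈p⇒1≤∣p∣ {x = x} x∈p =
  subst (_≤ _) (∣⁅x⁆∣≡1 x) (p⊆q⇒∣p∣≤∣q∣ λ y∈⁅x⁆ → subst (_∈ _) (sym (x∈⁅y⁆⇒x≡y x y∈⁅x⁆)) x∈p)

x∈p∧y∈p⇒2≤∣p∣ : ∀ {n} {x y : Fin n} {p : Subset n} → x ∈ p → y ∈ p → x ≢ y → 2 ≤ ∣ p ∣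
x∈p∧y∈p⇒2≤∣p∣ x∈p y∈p x≢y =
  ℕ.≤-<-trans (x∈p⇒1≤∣p∣ (x∈p∧x∉q⇒x∈p─q y∈p (x≢y⇒x∉⁅y⁆ (x≢y ∘ sym)))) (x∈p⇒∣p-x∣<∣p∣ x∈p)

-- N G v is definitionally toSubset (adj G v).
toSubset : ∀ {n} → (Fin n → Bool) → Subset n
toSubset f = tabulate (λ u → if f u then inside else outside)

toSubset-++ : ∀ m {n} (f : Fin (m + n) → Bool) →
              toSubset f ≡ toSubset (f ∘ (_↑ˡ n)) ++ toSubset (f ∘ (m ↑ʳ_))
toSubset-++ zero    f = refl
toSubset-++ (suc m) f = cong ((if f zero then inside else outside) ∷_) (toSubset-++ m (f ∘ suc))

toSubset-false : ∀ {n} → toSubset {n} (λ _ → false) ≡ ⊥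
toSubset-false {zero}  = refl
toSubset-false {suc n} = cong (outside ∷_) toSubset-false

v∉N[v] : ∀ {n} (G : Graph n) v → v ∉ N G v
v∉N[v] G v v∈N[v] = outside≢inside (begin
  outside                                       ≡⟨ cong (λ b → if b then inside else outside) (irrefl G v) ⟨
  (if adj G v v then inside else outside)       ≡⟨ lookup∘tabulate _ v ⟨
  Vec.lookup (N G v) v                          ≡⟨ []=⇒lookup v∈N[v] ⟩
  inside                                        ∎)
  where outside≢inside : outside ≢ inside
        outside≢inside ()

-- Pick x ∈ N(0) ∩ S and then y ∈ N(x) ∩ S; they differ because x ∉ N(x).
total12Set⇒2≤∣S∣ : ∀ {n} (G : Graph (suc n)) S → IsTotal12Set G S → 2 ≤ ∣ S ∣
total12Set⇒2≤∣S∣ G S total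
  with x , x∈N[0]∩S ← 1≤∣p∣⇒Nonempty _ (proj₁ (total zero))
  with y , y∈N[x]∩S ← 1≤∣p∣⇒Nonempty _ (proj₁ (total x))
  with x∈N[0] , x∈S ← x∈p∩q⁻ (N G zero) S x∈N[0]∩S
  with y∈N[x] , y∈S ← x∈p∩q⁻ (N G x) S y∈N[x]∩S
  = x∈p∧y∈p⇒2≤∣p∣ x∈S y∈S λ { refl → v∉N[v] G x y∈N[x] }

Between1And2 : ℕ → Set
Between1And2 c = 1 ≤ c × c ≤ 2

isTotal12Set? : ∀ {n} (G : Graph n) → Decidable (IsTotal12Set G)
isTotal12Set? G S = all? λ v → (1 ℕ.≤? _) ×-dec (_ ℕ.≤? 2)

minDegAtLeast? : ∀ {n} (G : Graph n) d → Dec (MinDegAtLeast G d)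
minDegAtLeast? G d = all? λ v → d ℕ.≤? deg G v

gammaT12Is? : ∀ {n} (G : Graph n) k → Dec (GammaT12Is G k)
gammaT12Is? G k =
  anySubset? (λ S → isTotal12Set? G S ×-dec (∣ S ∣ ℕ.≟ k)) ×-dec minimal?
  where
  minimal? : Dec (∀ S → IsTotal12Set G S → k ≤ ∣ S ∣)
  minimal? = map′
    (λ noSmaller S total → ℕ.≮⇒≥ λ ∣S∣<k → noSmaller (S , total , ∣S∣<k))
    (λ minimal (S , total , ∣S∣<k) → ℕ.<⇒≱ ∣S∣<k (minimal S total))
    (¬? (anySubset? λ S → isTotal12Set? G S ×-dec (∣ S ∣ ℕ.<? k)))

⊎-adj : ∀ {m n} → Graph m → Graph n → Fin m ⊎ Fin n → Fin m ⊎ Fin n → Bool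
⊎-adj G H (inj₁ u) (inj₁ v) = adj G u v
⊎-adj G H (inj₂ u) (inj₂ v) = adj H u v
⊎-adj G H (inj₁ u) (inj₂ v) = false
⊎-adj G H (inj₂ u) (inj₁ v) = false

⊎-adj-sym : ∀ {m n} (G : Graph m) (H : Graph n) x y → ⊎-adj G H x y ≡ ⊎-adj G H y x
⊎-adj-sym G H (inj₁ u) (inj₁ v) = Graph.sym G u v
⊎-adj-sym G H (inj₂ u) (inj₂ v) = Graph.sym H u v
⊎-adj-sym G H (inj₁ u) (inj₂ v) = refl
⊎-adj-sym G H (inj₂ u) (inj₁ v) = refl

⊎-adj-irrefl : ∀ {m n} (G : Graph m) (H : Graph n) x → ⊎-adj G H x x ≡ false
⊎-adj-irrefl G H (inj₁ u) = irrefl G u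
⊎-adj-irrefl G H (inj₂ u) = irrefl H u

infixr 5 _⊕_

_⊕_ : ∀ {m n} → Graph m → Graph n → Graph (m + n)
_⊕_ {m} G H = record
  { adj    = λ u v → ⊎-adj G H (splitAt m u) (splitAt m v)
  ; sym    = λ u v → ⊎-adj-sym G H (splitAt m u) (splitAt m v)
  ; irrefl = λ u → ⊎-adj-irrefl G H (splitAt m u)
  }

module _ {m n} (G : Graph m) (H : Graph n) where

  N-⊕ : ∀ x → N (G ⊕ H) x ≡ [ (λ u → N G u ++ ⊥) , (λ u → ⊥ ++ N H u) ]′ (splitAt m x)
  N-⊕ x = trans (toSubset-++ m _) (blocks (splitAt m x))
    where
    blocks : ∀ s → toSubset (⊎-adj G H s ∘ splitAt m ∘ (_↑ˡ n)) ++ toSubset (⊎-adj G H s ∘ splitAt m ∘ (m ↑ʳ_))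
                   ≡ [ (λ u → N G u ++ ⊥) , (λ u → ⊥ ++ N H u) ]′ s
    blocks s@(inj₁ u) = cong₂ _++_
      (tabulate-cong λ w → cong (λ t → if ⊎-adj G H s t then inside else outside) (splitAt-↑ˡ m w n))
      (trans (tabulate-cong λ w → cong (λ t → if ⊎-adj G H s t then inside else outside) (splitAt-↑ʳ m n w))
             toSubset-false)
    blocks s@(inj₂ u) = cong₂ _++_
      (trans (tabulate-cong λ w → cong (λ t → if ⊎-adj G H s t then inside else outside) (splitAt-↑ˡ m w n))
             toSubset-false)
      (tabulate-cong λ w → cong (λ t → if ⊎-adj G H s t then inside else outside) (splitAt-↑ʳ m n w))

  deg-⊕ : ∀ x → deg (G ⊕ H) x ≡ [ deg G , deg H ]′ (splitAt m x)
  deg-⊕ x = trans (cong ∣_∣ (N-⊕ x)) (count (splitAt m x))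
    where
    count : ∀ s → ∣ [ (λ u → N G u ++ ⊥) , (λ u → ⊥ ++ N H u) ]′ s ∣ ≡ [ deg G , deg H ]′ s
    count (inj₁ u) = trans (∣p++q∣≡∣p∣+∣q∣ (N G u) ⊥) (trans (cong (deg G u +_) (∣⊥∣≡0 n)) (ℕ.+-identityʳ _))
    count (inj₂ u) = trans (∣p++q∣≡∣p∣+∣q∣ (⊥ {m}) (N H u)) (cong (_+ deg H u) (∣⊥∣≡0 m))

  ∣N-⊕∩++∣ : ∀ x A B → ∣ N (G ⊕ H) x ∩ (A ++ B) ∣
                       ≡ [ (λ u → ∣ N G u ∩ A ∣) , (λ u → ∣ N H u ∩ B ∣) ]′ (splitAt m x)
  ∣N-⊕∩++∣ x A B = trans (cong (λ p → ∣ p ∩ (A ++ B) ∣) (N-⊕ x)) (count (splitAt m x))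
    where
    count : ∀ s → ∣ [ (λ u → N G u ++ ⊥) , (λ u → ⊥ ++ N H u) ]′ s ∩ (A ++ B) ∣
                  ≡ [ (λ u → ∣ N G u ∩ A ∣) , (λ u → ∣ N H u ∩ B ∣) ]′ s
    count (inj₁ u) = begin
      ∣ (N G u ++ ⊥) ∩ (A ++ B) ∣   ≡⟨ ∣p++q∩r++s∣≡∣p∩r∣+∣q∩s∣ (N G u) A ⊥ B ⟩
      ∣ N G u ∩ A ∣ + ∣ ⊥ ∩ B ∣     ≡⟨ cong (∣ N G u ∩ A ∣ +_) (∣⊥∩p∣≡0 B) ⟩
      ∣ N G u ∩ A ∣ + 0             ≡⟨ ℕ.+-identityʳ _ ⟩
      ∣ N G u ∩ A ∣                 ∎
    count (inj₂ u) = begin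
      ∣ (⊥ ++ N H u) ∩ (A ++ B) ∣   ≡⟨ ∣p++q∩r++s∣≡∣p∩r∣+∣q∩s∣ ⊥ A (N H u) B ⟩
      ∣ ⊥ ∩ A ∣ + ∣ N H u ∩ B ∣     ≡⟨ cong (_+ ∣ N H u ∩ B ∣) (∣⊥∩p∣≡0 A) ⟩
      ∣ N H u ∩ B ∣                 ∎

  minDegAtLeast-⊕ : ∀ {d} → MinDegAtLeast G d → MinDegAtLeast H d → MinDegAtLeast (G ⊕ H) d
  minDegAtLeast-⊕ {d} δG δH x =
    subst (d ≤_) (sym (deg-⊕ x)) ([_,_] {C = λ s → d ≤ [ deg G , deg H ]′ s} δG δH (splitAt m x))

  total12Set-⊕ : ∀ {A B} → IsTotal12Set G A → IsTotal12Set H B → IsTotal12Set (G ⊕ H) (A ++ B)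
  total12Set-⊕ {A} {B} totalA totalB x =
    subst Between1And2 (sym (∣N-⊕∩++∣ x A B))
      ([_,_] {C = λ s → Between1And2 ([ (λ u → ∣ N G u ∩ A ∣) , (λ u → ∣ N H u ∩ B ∣) ]′ s)}
             totalA totalB (splitAt m x))

  total12Set-⊕⁻ˡ : ∀ {A B} → IsTotal12Set (G ⊕ H) (A ++ B) → IsTotal12Set G A
  total12Set-⊕⁻ˡ {A} {B} total u =
    subst Between1And2 (trans (∣N-⊕∩++∣ (u ↑ˡ n) A B) (cong [ _ , _ ]′ (splitAt-↑ˡ m u n))) (total (u ↑ˡ n))

  total12Set-⊕⁻ʳ : ∀ {A B} → IsTotal12Set (G ⊕ H) (A ++ B) → IsTotal12Set H B
  total12Set-⊕⁻ʳ {A} {B} total u =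
    subst Between1And2 (trans (∣N-⊕∩++∣ (m ↑ʳ u) A B) (cong [ _ , _ ]′ (splitAt-↑ʳ m n u))) (total (m ↑ʳ u))

  gammaT12Is-⊕ : ∀ {a b} → GammaT12Is G a → GammaT12Is H b → GammaT12Is (G ⊕ H) (a + b)
  gammaT12Is-⊕ {a} {b} ((A , totalA , ∣A∣≡a) , minimalA) ((B , totalB , ∣B∣≡b) , minimalB) =
    (A ++ B , total12Set-⊕ totalA totalB , trans (∣p++q∣≡∣p∣+∣q∣ A B) (cong₂ _+_ ∣A∣≡a ∣B∣≡b)) , minimal
    where
    minimal : ∀ S → IsTotal12Set (G ⊕ H) S → a + b ≤ ∣ S ∣
    minimal S total with A′ , B′ , refl ← Vec.splitAt m S =
      subst (a + b ≤_) (sym (∣p++q∣≡∣p∣+∣q∣ A′ B′))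
        (ℕ.+-mono-≤ (minimalA A′ (total12Set-⊕⁻ˡ total)) (minimalB B′ (total12Set-⊕⁻ʳ total)))

Attainable : ℕ → ℕ → Set
Attainable n k = Σ[ G ∈ Graph n ] (MinDegAtLeast G 2 × GammaT12Is G k)

attainable-⊕ : ∀ {m n a b} → Attainable m a → Attainable n b → Attainable (m + n) (a + b)
attainable-⊕ (G , δG , γG) (H , δH , γH) =
  G ⊕ H , minDegAtLeast-⊕ G H δG δH , gammaT12Is-⊕ G H γG γH

attainable-≥ : ∀ {a n k} → a ≤ n → (∀ m → Attainable (a + m) k) → Attainable n k
attainable-≥ a≤n attainable with m , refl ← ℕ.m≤n⇒∃[o]m+o≡n a≤n = attainable m

complete : ∀ n → Graph n
complete n = record
  { adj    = λ u v → not (does (u ≟ v))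
  ; sym    = λ u v → cong not (does-⇔ (mk⇔ sym sym) (u ≟ v) (v ≟ u))
  ; irrefl = λ v → cong not (dec-true (v ≟ v) refl)
  }

N-complete : ∀ {n} (v : Fin n) → N (complete n) v ≡ ∁ ⁅ v ⁆
N-complete {suc n} zero    = cong (outside ∷_) (all-inside n)
  where
  all-inside : ∀ n → tabulate {n = n} (λ _ → inside) ≡ ∁ ⊥
  all-inside zero    = refl
  all-inside (suc n) = cong (inside ∷_) (all-inside n)
N-complete {suc n} (suc v) = cong (inside ∷_) (N-complete v)

deg-complete : ∀ {n} (v : Fin (suc n)) → deg (complete (suc n)) v ≡ n
deg-complete {n} v = begin
  ∣ N (complete (suc n)) v ∣   ≡⟨ cong ∣_∣ (N-complete v) ⟩
  ∣ ∁ ⁅ v ⁆ ∣                  ≡⟨ ∣∁p∣≡n∸∣p∣ ⁅ v ⁆ ⟩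
  suc n ∸ ∣ ⁅ v ⁆ ∣            ≡⟨ cong (suc n ∸_) (∣⁅x⁆∣≡1 v) ⟩
  n                            ∎

complete-total12Set : ∀ m → IsTotal12Set (complete (2 + m)) (inside ∷ inside ∷ ⊥)
complete-total12Set m v =
  subst (λ p → Between1And2 ∣ p ∩ (inside ∷ inside ∷ ⊥) ∣) (sym (N-complete v)) (count v)
  where
  count : (v : Fin (2 + m)) → Between1And2 ∣ ∁ ⁅ v ⁆ ∩ (inside ∷ inside ∷ ⊥) ∣
  count zero          rewrite ∣p∩⊥∣≡0 (∁ (⊥ {m})) = ℕ.≤-refl , s≤s z≤n
  count (suc zero)    rewrite ∣p∩⊥∣≡0 (∁ (⊥ {m})) = ℕ.≤-refl , s≤s z≤n
  count (suc (suc w)) rewrite ∣p∩⊥∣≡0 (∁ ⁅ w ⁆)    = s≤s z≤n , ℕ.≤-refl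

complete-gammaT12Is : ∀ m → GammaT12Is (complete (2 + m)) 2
complete-gammaT12Is m =
  (inside ∷ inside ∷ ⊥ , complete-total12Set m , cong (2 +_) (∣⊥∣≡0 m)) ,
  total12Set⇒2≤∣S∣ (complete (2 + m))

complete-attainable : ∀ m → Attainable (3 + m) 2
complete-attainable m =
  complete (3 + m) ,
  (λ v → subst (2 ≤_) (sym (deg-complete v)) (ℕ.m≤m+n 2 m)) ,
  complete-gammaT12Is (suc m)

next₅ : Fin 5 → Fin 5
next₅ v = suc (toℕ v) mod 5

C₅ : Graph 5
C₅ = record
  { adj    = cycleAdj
  ; sym    = λ u v → ∨-comm (does (v ≟ next₅ u)) _
  ; irrefl = toWitness {a? = all? λ v → cycleAdj v v ≟ᴮ false} _
  }
  where
  cycleAdj : Fin 5 → Fin 5 → Bool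
  cycleAdj u v = does (v ≟ next₅ u) ∨ does (u ≟ next₅ v)

C₅-attainable : Attainable 5 3
C₅-attainable =
  C₅ , toWitness {a? = minDegAtLeast? C₅ 2} _ , toWitness {a? = gammaT12Is? C₅ 3} _

triangles⊕complete : ∀ j m → Attainable (j * 3 + 3 + m) (2 + j * 2)
triangles⊕complete zero    m = complete-attainable m
triangles⊕complete (suc j) m = attainable-⊕ (complete-attainable 0) (triangles⊕complete j m)

data Parity : ℕ → Set where
  even : ∀ j → Parity (j * 2)
  odd  : ∀ j → Parity (1 + j * 2)

parity : ∀ k → Parity k
parity zero = even 0
parity (suc k) with parity k
... | even j = odd j
... | odd j  = even (suc j)

half-≤ : ∀ a b {n} → 2 * a + b ≤ 2 * n → a ≤ n
half-≤ a b h = ℕ.*-cancelˡ-≤ 2 (ℕ.≤-trans (ℕ.m≤m+n (2 * a) b) h)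

-- The hypothesis 8 ≤ k only serves to exclude k ∈ {0, 1, 3}.
proposition2p7 : (n k : ℕ) → 8 ≤ k → 3 * (k + 1) ≤ 2 * n →
    Σ[ G ∈ Graph n ] (MinDegAtLeast G 2 × GammaT12Is G k)
proposition2p7 n k 8≤k h with parity k
proposition2p7 n _ ()  h | even zero
proposition2p7 n _ (s≤s ()) h | odd zero
proposition2p7 n _ (s≤s (s≤s (s≤s ()))) h | odd (suc zero)
... | even (suc j) =
  attainable-≥ (half-≤ (j * 3 + 3) 3 (subst (_≤ 2 * n) (even-order j) h)) (triangles⊕complete j)
  where
  even-order : ∀ j → 3 * (2 + j * 2 + 1) ≡ 2 * (j * 3 + 3) + 3
  even-order = solve-∀
... | odd (suc (suc j)) =
  attainable-≥ (half-≤ (5 + (j * 3 + 3)) 2 (subst (_≤ 2 * n) (odd-order j) h))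
    (λ m → attainable-⊕ C₅-attainable (triangles⊕complete j m))
  where
  odd-order : ∀ j → 3 * (5 + j * 2 + 1) ≡ 2 * (5 + (j * 3 + 3)) + 2
  odd-order = solve-∀
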